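{- Let $u$ be a non-zero polynomial in $\mathbb{Z}\langle{\bf c},{\bf d}\rangle$ with non-negative coefficients. Then there exists a bounded balanced labeled acyclic digraph $G$ whose relation on the set of labels is a linear order and which satisfies $\Psi(G)=u$.
   Context: A labeled acyclic digraph $G=(V,E)$ is a directed graph (multiple edges allowed) with no directed cycles, locally finite, with a set $\Lambda$ carrying a binary relation $\sim$ and a labeling $\lambda:E\to\Lambda$; it is bounded if it has a unique source $\hat0$ and unique sink $\hat1$. "The relation is a linear order" means $\sim$ is a strict total order $<$ on $\Lambda$. Paths, $x\le y$ and intervals $[x,y]=\{z:x\le z\le y\}$ are as usual. A path $(e_1,\dots,e_k)$ is rising if $\lambda(e_i)\sim\lambda(e_{i+1})$ for all $i\le k-1$ and falling if $\lambda(e_i)\not\sim\lambda(e_{i+1})$ for all $i\le k-1$. $G$ is balanced if for every interval $[x,y]$ and every $k\ge0$ the numbers of rising and of falling paths from $x$ to $y$ of length $k$ agree. The descent word of a path $p=(e_1,\dots,e_k)$ is $u(p)=u_1\cdots u_{k-1}$ in non-commuting ${\bf a},{\bf b}$ with $u_i={\bf a}$ if $\lambda(e_i)\sim\lambda(e_{i+1})$ and ${\bf b}$ otherwise; $\Psi(G)=\sum_p u(p)$ over paths from $\hat0$ to $\hat1$. ${\bf c}={\bf a}+{\bf b}$, ${\bf d}={\bf a}{\bf b}+{\bf b}{\bf a}$, and $\mathbb{Z}\langle{\bf c},{\bf d}\rangle$ denotes integer polynomials in ${\bf c},{\bf d}$ (coefficients taken with respect to ${\bf c}{\bf d}$-monomials).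 -}

module Defs where

open import Level using (0ℓ)
open import Data.Bool using (Bool; true; false; _∧_; not; if_then_else_)
open import Data.Nat using (ℕ; zero; suc; _+_; _*_)
open import Data.Fin using (Fin; _≟_)
open import Data.List using (List; []; _∷_; length; map; concatMap; allFin)
open import Data.Product using (Σ; _×_; ∃)
open import Relation.Nullary using (¬_)
open import Relation.Nullary.Decidable using (⌊_⌋)
open import Relation.Binary.Bundles using (StrictTotalOrder)
open import Relation.Binary.PropositionalEquality using (_≡_)

data AB : Set where
  𝐚 𝐛 : AB

data CD : Set where
  𝐜 𝐝 : CD

_==ab_ : AB → AB → Bool
𝐚 ==ab 𝐚 = true
𝐛 ==ab 𝐛 = true
_ ==ab _ = false

_==cd_ : CD → CD → Bool
𝐜 ==cd 𝐜 = true
𝐝 ==cd 𝐝 = true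
_ ==cd _ = false

listEq : {A : Set} → (A → A → Bool) → List A → List A → Bool
listEq eq [] [] = true
listEq eq (x ∷ xs) (y ∷ ys) = eq x y ∧ listEq eq xs ys
listEq eq _ _ = false

-- A polynomial in ℤ⟨c,d⟩ with non-negative coefficients, given as a finite
-- formal sum  Σ k_i · m_i  of cd-monomials m_i with coefficients k_i ∈ ℕ
-- (repetitions of a monomial are allowed; their coefficients add up).
CDPoly : Set
CDPoly = List (List CD × ℕ)

open Data.Product using (_,_)

cdCoeff : CDPoly → List CD → ℕ
cdCoeff [] m = 0
cdCoeff ((m' , k) ∷ u) m = (if listEq _==cd_ m' m then k else 0) + cdCoeff u m

-- coefficient of the ab-word w in the ab-expansion of the cd-monomial m
-- (c = a + b, d = ab + ba)
expCount : List CD → List AB → ℕ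
expCount [] [] = 1
expCount [] (_ ∷ _) = 0
expCount (𝐜 ∷ m) [] = 0
expCount (𝐜 ∷ m) (_ ∷ w) = expCount m w
expCount (𝐝 ∷ m) (𝐚 ∷ 𝐛 ∷ w) = expCount m w
expCount (𝐝 ∷ m) (𝐛 ∷ 𝐚 ∷ w) = expCount m w
expCount (𝐝 ∷ m) _ = 0

abCoeff : CDPoly → List AB → ℕ
abCoeff [] w = 0
abCoeff ((m , k) ∷ u) w = k * expCount m w + abCoeff u w

record LDigraph (Λ : Set) : Set where
  field
    nV nE : ℕ
    src tgt : Fin nE → Fin nV
    lab : Fin nE → Λ
open LDigraph public

module _ {Λ : Set} (G : LDigraph Λ) where

  Edge = Fin (nE G)
  Vert = Fin (nV G)

  isPath : Vert → List Edge → Vert → Bool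
  isPath x [] y = ⌊ x ≟ y ⌋
  isPath x (e ∷ es) y = ⌊ src G e ≟ x ⌋ ∧ isPath (tgt G e) es y

  IsPath : Vert → List Edge → Vert → Set
  IsPath x es y = isPath x es y ≡ true

  Acyclic : Set
  Acyclic = (x : Vert) (e : Edge) (es : List Edge) → ¬ IsPath x (e ∷ es) x

  IsSource IsSink : Vert → Set
  IsSource v = (e : Edge) → ¬ (tgt G e ≡ v)
  IsSink v = (e : Edge) → ¬ (src G e ≡ v)

  IsUniqueSource IsUniqueSink : Vert → Set
  IsUniqueSource s = IsSource s × ((v : Vert) → IsSource v → v ≡ s)
  IsUniqueSink t = IsSink t × ((v : Vert) → IsSink v → v ≡ t)

  seqs : ℕ → List (List Edge)
  seqs zero = [] ∷ []
  seqs (suc k) = concatMap (λ e → map (e ∷_) (seqs k)) (allFin (nE G))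

  countB : {A : Set} → (A → Bool) → List A → ℕ
  countB p [] = 0
  countB p (x ∷ xs) = (if p x then 1 else 0) + countB p xs

module _ (O : StrictTotalOrder 0ℓ 0ℓ 0ℓ) (G : LDigraph (StrictTotalOrder.Carrier O)) where
  open StrictTotalOrder O using (_<?_)

  rel : Edge G → Edge G → Bool
  rel e e' = ⌊ lab G e <? lab G e' ⌋

  rising falling : List (Edge G) → Bool
  rising [] = true
  rising (e ∷ []) = true
  rising (e ∷ e' ∷ es) = rel e e' ∧ rising (e' ∷ es)
  falling [] = true
  falling (e ∷ []) = true
  falling (e ∷ e' ∷ es) = not (rel e e') ∧ falling (e' ∷ es)

  nRising nFalling : Vert G → Vert G → ℕ → ℕ
  nRising x y k = countB G (λ es → isPath G x es y ∧ rising es) (seqs G k)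
  nFalling x y k = countB G (λ es → isPath G x es y ∧ falling es) (seqs G k)

  Balanced : Set
  Balanced = (x y : Vert G) (k : ℕ) → nRising x y k ≡ nFalling x y k

  descent : List (Edge G) → List AB
  descent [] = []
  descent (e ∷ []) = []
  descent (e ∷ e' ∷ es) = (if rel e e' then 𝐚 else 𝐛) ∷ descent (e' ∷ es)

  -- coefficient of the ab-word w in Ψ(G) = Σ_p u(p), p ranging over the
  -- (non-empty) paths from 0̂ = s to 1̂ = t; such p have length |w|+1.
  ΨCoeff : Vert G → Vert G → List AB → ℕ
  ΨCoeff s t w =
    countB G (λ es → isPath G s es t ∧ listEq _==ab_ (descent es) w)
             (seqs G (suc (length w)))

module Submission where

-- Each cd-monomial m becomes a chain, a path of bundles of parallel edges: a letter c is
-- a pair of edges labelled ±(h+1), a letter d an edge labelled 0 followed by such a pair,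
-- h being the degree of the rest of m; its descent words are exactly the ab-expansion of m.
-- The graph is the bouquet of the chains of the monomials of u, repeated according to
-- their coefficients: all chains share the source 0 and the sink T, nothing else.
--
-- This gives balancedness when every adjacency list is
-- invariant under negating labels and consecutive edges carry distinct labels (negation
-- exchanges rising and falling paths), and Ψ as a sum over the first edge.

open import Defs
open import Level using (0ℓ)
open import Data.Nat using (ℕ)
open import Data.List using (List)
open import Data.Product using (Σ; _×_; ∃)
open import Relation.Nullary using (¬_)
open import Relation.Binary.Bundles using (StrictTotalOrder)
open import Relation.Binary.PropositionalEquality using (_≡_)

open import Data.Bool using (Bool; true; false; _∧_; not; if_then_else_)
open import Data.Bool.Properties using (∧-conicalˡ; ∧-conicalʳ; ∧-identityʳ; ∧-commutativeMonoid)
open import Algebra.Bundles using (CommutativeMonoid)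
open import Algebra.Properties.CommutativeSemigroup (CommutativeMonoid.commutativeSemigroup ∧-commutativeMonoid)
  renaming (interchange to ∧-interchange)
open import Data.Nat using (zero; suc; _+_; _*_; _≤_; _<_; s≤s; z≤n)
open import Data.Nat.Properties as ℕ using (≤-refl; <-irrefl; +-identityʳ; +-assoc)
open import Data.Nat.DivMod using (_mod_; m<n⇒m%n≡m)
open import Data.Integer as ℤ using (ℤ; -_)
import Data.Integer.Properties as ℤ
open import Data.Fin using (Fin; toℕ; _≟_)
open import Data.Fin.Properties using (toℕ-fromℕ<; toℕ-injective; toℕ<n)
open import Data.List using ([]; _∷_; _++_; length; map; concatMap; allFin; tabulate; lookup; downFrom; replicate)
open import Data.List.Properties using (map-tabulate; tabulate-lookup; length-++)
open import Data.List.Relation.Unary.Any using (here; there; index)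
open import Data.List.Relation.Unary.Any.Properties using (lookup-index; ¬Any[])
open import Data.List.Membership.Propositional using (_∈_; find; lose)
open import Data.List.Membership.Propositional.Properties
  using (∈-lookup; ∈-map⁺; ∈-map⁻; ∈-++⁺ˡ; ∈-++⁺ʳ; ∈-++⁻; ∈-concatMap⁺; ∈-concatMap⁻; ∈-downFrom⁺)
open import Data.Maybe using (Maybe; just; nothing)
open import Data.List.NonEmpty as List⁺ using (List⁺; _∷_; head; tail; toList; _∷⁺_; [_])
open import Data.List.Relation.Unary.All as All using (All; _∷_)
import Data.List.Relation.Unary.All.Properties as All
open import Data.List.Relation.Unary.Linked as Linked using (Linked; _∷_)
open import Data.List.Relation.Binary.Disjoint.Propositional using (Disjoint)
open import Data.List.Relation.Binary.Subset.Propositional using (_⊆_)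
open import Data.Product using (_,_; proj₁; proj₂; ∃₂)
open import Data.Empty using (⊥-elim)
open import Data.Sum using (inj₁; inj₂)
open import Data.Unit using (⊤; tt)
open import Relation.Nullary using (yes; no)
open import Relation.Nullary.Decidable using (⌊_⌋)
open import Relation.Binary.Definitions using (tri<; tri≈; tri>)
open import Relation.Binary.PropositionalEquality
  using (_≢_; refl; sym; trans; cong; cong₂; subst; module ≡-Reasoning)

sumL : {X : Set} → (X → ℕ) → List X → ℕ
sumL f [] = 0
sumL f (x ∷ xs) = f x + sumL f xs

sumL-cong : {X : Set} {f g : X → ℕ} (xs : List X) →
            (∀ x → x ∈ xs → f x ≡ g x) → sumL f xs ≡ sumL g xs
sumL-cong [] _ = refl
sumL-cong (x ∷ xs) f≡g = cong₂ _+_ (f≡g x (here refl)) (sumL-cong xs (λ y y∈ → f≡g y (there y∈)))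

sumL-++ : {X : Set} (f : X → ℕ) (xs ys : List X) → sumL f (xs ++ ys) ≡ sumL f xs + sumL f ys
sumL-++ f [] ys = refl
sumL-++ f (x ∷ xs) ys = trans (cong (f x +_) (sumL-++ f xs ys)) (sym (+-assoc (f x) _ _))

sumL-map : {X Y : Set} (f : Y → ℕ) (g : X → Y) (xs : List X) → sumL f (map g xs) ≡ sumL (λ x → f (g x)) xs
sumL-map f g [] = refl
sumL-map f g (x ∷ xs) = cong (f (g x) +_) (sumL-map f g xs)

sumL-concatMap : {X Y : Set} (f : Y → ℕ) (g : X → List Y) (xs : List X) →
                 sumL f (concatMap g xs) ≡ sumL (λ x → sumL f (g x)) xs
sumL-concatMap f g [] = refl
sumL-concatMap f g (x ∷ xs) = trans (sumL-++ f (g x) (concatMap g xs)) (cong (sumL f (g x) +_) (sumL-concatMap f g xs))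

sumL-guard : {X : Set} (b : Bool) (f : X → ℕ) (xs : List X) →
             sumL (λ x → if b then f x else 0) xs ≡ (if b then sumL f xs else 0)
sumL-guard true f xs = refl
sumL-guard false f [] = refl
sumL-guard false f (x ∷ xs) = sumL-guard false f xs

sumL-allFin : {X : Set} (xs : List X) (f : X → ℕ) → sumL (λ i → f (lookup xs i)) (allFin (length xs)) ≡ sumL f xs
sumL-allFin xs f = begin
  sumL (λ i → f (lookup xs i)) (allFin (length xs))  ≡⟨ sumL-map f (lookup xs) (allFin (length xs)) ⟨
  sumL f (map (lookup xs) (allFin (length xs)))      ≡⟨ cong (sumL f) (map-tabulate (λ i → i) (lookup xs)) ⟩
  sumL f (tabulate (lookup xs))                      ≡⟨ cong (sumL f) (tabulate-lookup xs) ⟩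
  sumL f xs                                          ∎
  where open ≡-Reasoning

sum-downFrom-none : ∀ n v (f : ℕ → ℕ) → n ≤ v →
                    sumL (λ a → if ⌊ a ℕ.≟ v ⌋ then f a else 0) (downFrom n) ≡ 0
sum-downFrom-none zero v f _ = refl
sum-downFrom-none (suc n) v f n<v with n ℕ.≟ v
... | yes refl = ⊥-elim (<-irrefl refl n<v)
... | no _ = sum-downFrom-none n v f (ℕ.<⇒≤ n<v)

sum-downFrom-pick : ∀ n v (f : ℕ → ℕ) → v < n →
                    sumL (λ a → if ⌊ a ℕ.≟ v ⌋ then f a else 0) (downFrom n) ≡ f v
sum-downFrom-pick (suc n) v f v<1+n with n ℕ.≟ v
... | yes refl = trans (cong (f n +_) (sum-downFrom-none n n f ≤-refl)) (+-identityʳ (f n))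
... | no n≢v = sum-downFrom-pick n v f (ℕ.≤∧≢⇒< (ℕ.≤-pred v<1+n) (λ v≡n → n≢v (sym v≡n)))

module _ {Λ : Set} (G : LDigraph Λ) where

  countB-++ : {X : Set} (p : X → Bool) (xs ys : List X) → countB G p (xs ++ ys) ≡ countB G p xs + countB G p ys
  countB-++ p [] ys = refl
  countB-++ p (x ∷ xs) ys = trans (cong (_ +_) (countB-++ p xs ys)) (sym (+-assoc (if p x then 1 else 0) _ _))

  countB-map : {X Y : Set} (p : Y → Bool) (g : X → Y) (xs : List X) →
               countB G p (map g xs) ≡ countB G (λ x → p (g x)) xs
  countB-map p g [] = refl
  countB-map p g (x ∷ xs) = cong (_ +_) (countB-map p g xs)

  countB-concatMap : {X Y : Set} (p : Y → Bool) (g : X → List Y) (xs : List X) →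
                     countB G p (concatMap g xs) ≡ sumL (λ x → countB G p (g x)) xs
  countB-concatMap p g [] = refl
  countB-concatMap p g (x ∷ xs) = trans (countB-++ p (g x) (concatMap g xs)) (cong (_ +_) (countB-concatMap p g xs))

  countB-cong : {X : Set} {p q : X → Bool} (xs : List X) → (∀ x → p x ≡ q x) → countB G p xs ≡ countB G q xs
  countB-cong [] _ = refl
  countB-cong (x ∷ xs) p≡q = cong₂ _+_ (cong (λ b → if b then 1 else 0) (p≡q x)) (countB-cong xs p≡q)

  countB-guard : {X : Set} (b : Bool) (q : X → Bool) (xs : List X) →
                 countB G (λ x → b ∧ q x) xs ≡ (if b then countB G q xs else 0)
  countB-guard true q xs = refl
  countB-guard false q [] = refl
  countB-guard false q (x ∷ xs) = countB-guard false q xs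

guard-∧ : (a b : Bool) (u : ℕ) → (if a ∧ b then u else 0) ≡ (if a then (if b then u else 0) else 0)
guard-∧ true b u = refl
guard-∧ false b u = refl

vertex : (T : ℕ) → ℕ → Fin (suc T)
vertex T a = a mod suc T

toℕ-vertex : ∀ {T a} → a ≤ T → toℕ (vertex T a) ≡ a
toℕ-vertex a≤T = trans (toℕ-fromℕ< _) (m<n⇒m%n≡m (s≤s a≤T))

vertex-toℕ : ∀ {T} (v : Fin (suc T)) → vertex T (toℕ v) ≡ v
vertex-toℕ v = toℕ-injective (toℕ-vertex (ℕ.≤-pred (toℕ<n v)))

≟-toℕ : ∀ {n} (x y : Fin n) → ⌊ x ≟ y ⌋ ≡ ⌊ toℕ x ℕ.≟ toℕ y ⌋
≟-toℕ x y with x ≟ y | toℕ x ℕ.≟ toℕ y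
... | yes _ | yes _ = refl
... | yes x≡y | no x≢y = ⊥-elim (x≢y (cong toℕ x≡y))
... | no x≢y | yes x≡y = ⊥-elim (x≢y (toℕ-injective x≡y))
... | no _ | no _ = refl

≟-sound : ∀ {n} {x y : Fin n} → ⌊ x ≟ y ⌋ ≡ true → x ≡ y
≟-sound {x = x} {y} x≟y with x ≟ y | x≟y
... | yes x≡y | _ = x≡y
... | no _ | ()

ℤ-order : StrictTotalOrder 0ℓ 0ℓ 0ℓ
ℤ-order = ℤ.<-strictTotalOrder

open StrictTotalOrder ℤ-order using (_<?_)

less : ℤ → ℤ → Bool
less ℓ ℓ' = ⌊ ℓ <? ℓ' ⌋

letter : ℤ → ℤ → AB
letter ℓ ℓ' = if less ℓ ℓ' then 𝐚 else 𝐛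

less-neg : ∀ {ℓ ℓ'} → ℓ ≢ ℓ' → not (less (- ℓ) (- ℓ')) ≡ less ℓ ℓ'
less-neg {ℓ} {ℓ'} ℓ≢ℓ' with (- ℓ) <? (- ℓ') | ℓ <? ℓ'
... | yes -ℓ<-ℓ' | yes ℓ<ℓ' = ⊥-elim (ℤ.<-asym ℓ<ℓ' (ℤ.neg-cancel-< -ℓ<-ℓ'))
... | yes _ | no _ = refl
... | no _ | yes _ = refl
... | no -ℓ≮-ℓ' | no ℓ≮ℓ' with ℤ.<-cmp ℓ ℓ'
...   | tri< ℓ<ℓ' _ _ = ⊥-elim (ℓ≮ℓ' ℓ<ℓ')
...   | tri≈ _ ℓ≡ℓ' _ = ⊥-elim (ℓ≢ℓ' ℓ≡ℓ')
...   | tri> _ _ ℓ>ℓ' = ⊥-elim (-ℓ≮-ℓ' (ℤ.neg-mono-< ℓ>ℓ'))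

-- an adjacency list that is invariant under negating all labels
Symmetric : List (ℕ × ℤ) → Set
Symmetric L = ∀ (g : ℕ × ℤ → ℕ) → sumL g L ≡ sumL (λ p → g (proj₁ p , - proj₂ p)) L

-- A forward graph on the vertices 0, …, T is given by adjacency lists: A a lists the
-- pairs (z , ℓ), one for each edge a → z labelled ℓ, and every edge goes from a smaller
-- to a larger vertex.  Acyclicity is automatic; all path counts can be computed by
-- recursion along the adjacency lists.

module ForwardGraph (T : ℕ) (A : ℕ → List (ℕ × ℤ))
                    (forward : ∀ {a z ℓ} → (z , ℓ) ∈ A a → a < z × z ≤ T) where

  table : List (ℕ × ℕ × ℤ)
  table = concatMap (λ a → map (a ,_) (A a)) (downFrom (suc T))

  from to : Fin (length table) → ℕ
  from e = proj₁ (lookup table e)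
  to e = proj₁ (proj₂ (lookup table e))

  graph : LDigraph ℤ
  graph = record { nV = suc T ; nE = length table
                 ; src = λ e → vertex T (from e) ; tgt = λ e → vertex T (to e)
                 ; lab = λ e → proj₂ (proj₂ (lookup table e)) }

  ∈-table⁻ : ∀ {a z ℓ} → (a , z , ℓ) ∈ table → (z , ℓ) ∈ A a
  ∈-table⁻ t∈ with find (∈-concatMap⁻ (λ a → map (a ,_) (A a)) {xs = downFrom (suc T)} t∈)
  ... | a , _ , t∈a with ∈-map⁻ (a ,_) t∈a
  ...   | _ , p∈ , refl = p∈

  ∈-table⁺ : ∀ {a z ℓ} → (z , ℓ) ∈ A a → (a , z , ℓ) ∈ table
  ∈-table⁺ {a} p∈ with forward p∈
  ... | a<z , z≤T = ∈-concatMap⁺ (λ a → map (a ,_) (A a))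
                      (lose (∈-downFrom⁺ (s≤s (ℕ.<⇒≤ (ℕ.<-≤-trans a<z z≤T)))) (∈-map⁺ (a ,_) p∈))

  edge-forward : ∀ e → from e < to e × to e ≤ T
  edge-forward e = forward (∈-table⁻ (∈-lookup {xs = table} e))

  from≤T : ∀ e → from e ≤ T
  from≤T e = ℕ.<⇒≤ (ℕ.<-≤-trans (proj₁ (edge-forward e)) (proj₂ (edge-forward e)))

  toℕ-src : ∀ e → toℕ (src graph e) ≡ from e
  toℕ-src e = toℕ-vertex (from≤T e)

  toℕ-tgt : ∀ e → toℕ (tgt graph e) ≡ to e
  toℕ-tgt e = toℕ-vertex (proj₂ (edge-forward e))

  edge-of : ∀ {a z ℓ} → (z , ℓ) ∈ A a → Σ (Edge graph) λ e → lookup table e ≡ (a , z , ℓ)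
  edge-of p∈ = index t∈ , sym (lookup-index t∈)
    where t∈ = ∈-table⁺ p∈

  path-≤ : ∀ x es y → IsPath graph x es y → toℕ x ≤ toℕ y
  path-< : ∀ x e es y → IsPath graph x (e ∷ es) y → toℕ x < toℕ y
  path-≤ x [] y x≡y = ℕ.≤-reflexive (cong toℕ (≟-sound x≡y))
  path-≤ x (e ∷ es) y path = ℕ.<⇒≤ (path-< x e es y path)
  path-< x e es y path = begin-strict
      toℕ x            ≡⟨ cong toℕ (≟-sound (∧-conicalˡ _ _ path)) ⟨
      toℕ (src graph e) ≡⟨ toℕ-src e ⟩
      from e           <⟨ proj₁ (edge-forward e) ⟩
      to e             ≡⟨ toℕ-tgt e ⟨
      toℕ (tgt graph e) ≤⟨ path-≤ (tgt graph e) es y (∧-conicalʳ _ _ path) ⟩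
      toℕ y            ∎
    where open ℕ.≤-Reasoning

  acyclic : Acyclic graph
  acyclic x e es cycle = <-irrefl refl (path-< x e es x cycle)

  unique-source : (∀ v → 0 < v → v ≤ T → ∃₂ λ a ℓ → (v , ℓ) ∈ A a) → IsUniqueSource graph (vertex T 0)
  unique-source has-in = no-in , only
    where
    no-in : IsSource graph (vertex T 0)
    no-in e tgt≡0 = ℕ.n≮0 (subst (from e <_) to≡0 (proj₁ (edge-forward e)))
      where to≡0 = trans (sym (toℕ-tgt e)) (trans (cong toℕ tgt≡0) (toℕ-vertex {T} z≤n))
    entered : ∀ v → 0 < toℕ v → ¬ IsSource graph v
    entered v 0<v v-source with has-in (toℕ v) 0<v (ℕ.≤-pred (toℕ<n v))
    ... | a , ℓ , p∈ with edge-of p∈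
    ...   | e , e≡ = v-source e (trans (cong (λ t → vertex T (proj₁ (proj₂ t))) e≡) (vertex-toℕ v))
    only : ∀ v → IsSource graph v → v ≡ vertex T 0
    only v v-source = toℕ-injective (trans (ℕ.n≤0⇒n≡0 (ℕ.≮⇒≥ λ 0<v → entered v 0<v v-source))
                                           (sym (toℕ-vertex {T} z≤n)))

  unique-sink : (∀ v → v < T → ∃ λ p → p ∈ A v) → IsUniqueSink graph (vertex T T)
  unique-sink has-out = no-out , only
    where
    no-out : IsSink graph (vertex T T)
    no-out e src≡T = <-irrefl refl
      (ℕ.<-≤-trans (subst (_< to e) from≡T (proj₁ (edge-forward e))) (proj₂ (edge-forward e)))
      where from≡T = trans (sym (toℕ-src e)) (trans (cong toℕ src≡T) (toℕ-vertex ≤-refl))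
    left : ∀ v → toℕ v < T → ¬ IsSink graph v
    left v v<T v-sink with has-out (toℕ v) v<T
    ... | _ , p∈ with edge-of p∈
    ...   | e , e≡ = v-sink e (trans (cong (λ t → vertex T (proj₁ t)) e≡) (vertex-toℕ v))
    only : ∀ v → IsSink graph v → v ≡ vertex T T
    only v v-sink = toℕ-injective
      (trans (ℕ.≤-antisym (ℕ.≤-pred (toℕ<n v)) (ℕ.≮⇒≥ λ v<T → left v v<T v-sink)) (sym (toℕ-vertex ≤-refl)))

  table-from : ∀ v (h : ℕ × ℤ → ℕ) → v ≤ T →
               sumL (λ t → if ⌊ proj₁ t ℕ.≟ v ⌋ then h (proj₂ t) else 0) table ≡ sumL h (A v)
  table-from v h v≤T = begin
      sumL leaving table
    ≡⟨ sumL-concatMap leaving (λ a → map (a ,_) (A a)) (downFrom (suc T)) ⟩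
      sumL (λ a → sumL leaving (map (a ,_) (A a))) (downFrom (suc T))
    ≡⟨ sumL-cong (downFrom (suc T)) (λ a _ →
         trans (sumL-map leaving (a ,_) (A a)) (sumL-guard ⌊ a ℕ.≟ v ⌋ h (A a))) ⟩
      sumL (λ a → if ⌊ a ℕ.≟ v ⌋ then sumL h (A a) else 0) (downFrom (suc T))
    ≡⟨ sum-downFrom-pick (suc T) v (λ a → sumL h (A a)) (s≤s v≤T) ⟩
      sumL h (A v) ∎
    where
    open ≡-Reasoning
    leaving : ℕ × ℕ × ℤ → ℕ
    leaving t = if ⌊ proj₁ t ℕ.≟ v ⌋ then h (proj₂ t) else 0

  -- A deterministic automaton reading the labels along a path: in state σ it admits the
  -- label ℓ or not, moves to state next σ ℓ, and in the end accepts or rejects.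
  module Automaton {S : Set} (accept : S → Bool) (admits : S → ℤ → Bool) (next : S → ℤ → S) where

    runs : S → List (Edge graph) → Bool
    runs σ [] = accept σ
    runs σ (e ∷ es) = admits σ (lab graph e) ∧ runs (next σ (lab graph e)) es

    paths : ℕ → ℕ → ℕ → S → ℕ
    paths x y zero σ = if ⌊ x ℕ.≟ y ⌋ ∧ accept σ then 1 else 0
    paths x y (suc k) σ =
      sumL (λ p → if admits σ (proj₂ p) then paths (proj₁ p) y k (next σ (proj₂ p)) else 0) (A x)

    accepted : Vert graph → Vert graph → S → List (Edge graph) → Bool
    accepted x y σ es = isPath graph x es y ∧ runs σ es

    paths-correct : ∀ k (x y : Vert graph) σ →
                    countB graph (accepted x y σ) (seqs graph k) ≡ paths (toℕ x) (toℕ y) k σ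
    paths-correct zero x y σ = trans (+-identityʳ _) (cong (λ b → if b ∧ accept σ then 1 else 0) (≟-toℕ x y))
    paths-correct (suc k) x y σ = begin
        countB graph (accepted x y σ) (seqs graph (suc k))
      ≡⟨ countB-concatMap graph (accepted x y σ) (λ e → map (e ∷_) (seqs graph k)) (allFin (length table)) ⟩
        sumL (λ e → countB graph (accepted x y σ) (map (e ∷_) (seqs graph k))) (allFin (length table))
      ≡⟨ sumL-cong (allFin (length table)) (λ e _ → first-edge e) ⟩
        sumL (λ e → out (lookup table e)) (allFin (length table))
      ≡⟨ sumL-allFin table out ⟩
        sumL out table
      ≡⟨ sumL-cong table (λ t _ → guard-∧ ⌊ proj₁ t ℕ.≟ toℕ x ⌋ _ _) ⟩
        sumL (λ t → if ⌊ proj₁ t ℕ.≟ toℕ x ⌋ then continue (proj₂ t) else 0) table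
      ≡⟨ table-from (toℕ x) continue (ℕ.≤-pred (toℕ<n x)) ⟩
        paths (toℕ x) (toℕ y) (suc k) σ ∎
      where
      open ≡-Reasoning
      continue : ℕ × ℤ → ℕ
      continue (z , ℓ) = if admits σ ℓ then paths z (toℕ y) k (next σ ℓ) else 0
      out : ℕ × ℕ × ℤ → ℕ
      out (a , z , ℓ) = if ⌊ a ℕ.≟ toℕ x ⌋ ∧ admits σ ℓ then paths z (toℕ y) k (next σ ℓ) else 0
      first-edge : ∀ e → countB graph (accepted x y σ) (map (e ∷_) (seqs graph k)) ≡ out (lookup table e)
      first-edge e = begin
          countB graph (accepted x y σ) (map (e ∷_) (seqs graph k))
        ≡⟨ countB-map graph (accepted x y σ) (e ∷_) (seqs graph k) ⟩
          countB graph (λ es → (⌊ src graph e ≟ x ⌋ ∧ isPath graph (tgt graph e) es y) ∧ (admits σ ℓ ∧ runs (next σ ℓ) es))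
                 (seqs graph k)
        ≡⟨ countB-cong graph (seqs graph k) (λ es → ∧-interchange ⌊ src graph e ≟ x ⌋ _ _ _) ⟩
          countB graph (λ es → (⌊ src graph e ≟ x ⌋ ∧ admits σ ℓ) ∧ accepted (tgt graph e) y (next σ ℓ) es) (seqs graph k)
        ≡⟨ countB-guard graph (⌊ src graph e ≟ x ⌋ ∧ admits σ ℓ) _ (seqs graph k) ⟩
          (if ⌊ src graph e ≟ x ⌋ ∧ admits σ ℓ
           then countB graph (accepted (tgt graph e) y (next σ ℓ)) (seqs graph k) else 0)
        ≡⟨ cong₂ (λ b n → if b ∧ admits σ ℓ then n else 0) leaves-x rest ⟩
          out (lookup table e) ∎
        where
        ℓ = lab graph e
        leaves-x : ⌊ src graph e ≟ x ⌋ ≡ ⌊ from e ℕ.≟ toℕ x ⌋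
        leaves-x = trans (≟-toℕ (src graph e) x) (cong (λ a → ⌊ a ℕ.≟ toℕ x ⌋) (toℕ-src e))
        rest : countB graph (accepted (tgt graph e) y (next σ ℓ)) (seqs graph k) ≡ paths (to e) (toℕ y) k (next σ ℓ)
        rest = trans (paths-correct k (tgt graph e) y (next σ ℓ))
                     (cong (λ z → paths z (toℕ y) k (next σ ℓ)) (toℕ-tgt e))

  after : (ℤ → ℤ → Bool) → Maybe ℤ → ℤ → Bool
  after r nothing _ = true
  after r (just ℓ) ℓ' = r ℓ ℓ'

  module Rising = Automaton (λ _ → true) (after less) (λ _ → just)
  module Falling = Automaton (λ _ → true) (after (λ ℓ ℓ' → not (less ℓ ℓ'))) (λ _ → just)

  rising-after : ∀ e es → rising ℤ-order graph (e ∷ es) ≡ Rising.runs (just (lab graph e)) es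
  rising-after e [] = refl
  rising-after e (e' ∷ es) = cong (less (lab graph e) (lab graph e') ∧_) (rising-after e' es)

  falling-after : ∀ e es → falling ℤ-order graph (e ∷ es) ≡ Falling.runs (just (lab graph e)) es
  falling-after e [] = refl
  falling-after e (e' ∷ es) = cong (not (less (lab graph e) (lab graph e')) ∧_) (falling-after e' es)

  rising-runs : ∀ es → rising ℤ-order graph es ≡ Rising.runs nothing es
  rising-runs [] = refl
  rising-runs (e ∷ es) = rising-after e es

  falling-runs : ∀ es → falling ℤ-order graph es ≡ Falling.runs nothing es
  falling-runs [] = refl
  falling-runs (e ∷ es) = falling-after e es

  -- If all adjacency lists are symmetric and two consecutive edges never carry the same
  -- label, then negating the labels exchanges rising and falling paths: G is balanced.
  module _ (symmetric : ∀ a → Symmetric (A a))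
           (fresh : ∀ {a z ℓ z' ℓ'} → (z , ℓ) ∈ A a → (z' , ℓ') ∈ A z → ℓ' ≢ ℓ) where

    rising≡falling : ∀ k x y ℓ → (∀ {z ℓ'} → (z , ℓ') ∈ A x → ℓ' ≢ ℓ) →
                     Rising.paths x y k (just ℓ) ≡ Falling.paths x y k (just (- ℓ))
    rising≡falling zero x y ℓ _ = refl
    rising≡falling (suc k) x y ℓ ℓ-fresh = begin
        Rising.paths x y (suc k) (just ℓ)
      ≡⟨ sumL-cong (A x) (λ p p∈ → cong₂ (λ b n → if b then n else 0)
           (sym (less-neg (λ ℓ≡ → ℓ-fresh p∈ (sym ℓ≡))))
           (rising≡falling k (proj₁ p) y (proj₂ p) (fresh p∈))) ⟩
        sumL (λ p → if not (less (- ℓ) (- proj₂ p)) then Falling.paths (proj₁ p) y k (just (- proj₂ p)) else 0) (A x)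
      ≡⟨ symmetric x _ ⟨
        Falling.paths x y (suc k) (just (- ℓ)) ∎
      where open ≡-Reasoning

    -- split off the first edge, whose label is unconstrained, and negate the rest
    balanced : Balanced ℤ-order graph
    balanced x y zero = refl
    balanced x y (suc k) = begin
        nRising ℤ-order graph x y (suc k)
      ≡⟨ countB-cong graph (seqs graph (suc k)) (λ es → cong (isPath graph x es y ∧_) (rising-runs es)) ⟩
        countB graph (Rising.accepted x y nothing) (seqs graph (suc k))
      ≡⟨ Rising.paths-correct (suc k) x y nothing ⟩
        sumL (λ p → Rising.paths (proj₁ p) (toℕ y) k (just (proj₂ p))) (A (toℕ x))
      ≡⟨ sumL-cong (A (toℕ x)) (λ p p∈ → rising≡falling k (proj₁ p) (toℕ y) (proj₂ p) (fresh p∈)) ⟩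
        sumL (λ p → Falling.paths (proj₁ p) (toℕ y) k (just (- proj₂ p))) (A (toℕ x))
      ≡⟨ symmetric (toℕ x) _ ⟨
        sumL (λ p → Falling.paths (proj₁ p) (toℕ y) k (just (proj₂ p))) (A (toℕ x))
      ≡⟨ Falling.paths-correct (suc k) x y nothing ⟨
        countB graph (Falling.accepted x y nothing) (seqs graph (suc k))
      ≡⟨ countB-cong graph (seqs graph (suc k)) (λ es → cong (isPath graph x es y ∧_) (falling-runs es)) ⟨
        nFalling ℤ-order graph x y (suc k) ∎
      where open ≡-Reasoning

  -- The descent-word automaton: its state is the previous label (if any) and the part of
  -- the word still to be read.
  descent-admits : Maybe ℤ × List AB → ℤ → Bool
  descent-admits (nothing , w) _ = true
  descent-admits (just ℓ , []) _ = false
  descent-admits (just ℓ , x ∷ w) ℓ' = letter ℓ ℓ' ==ab x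

  descent-next : Maybe ℤ × List AB → ℤ → Maybe ℤ × List AB
  descent-next (nothing , w) ℓ = just ℓ , w
  descent-next (just _ , []) ℓ = just ℓ , []
  descent-next (just _ , _ ∷ w) ℓ = just ℓ , w

  module Descent = Automaton (λ σ → listEq _==ab_ [] (proj₂ σ)) descent-admits descent-next

  descent-after : ∀ e es w →
                  listEq _==ab_ (descent ℤ-order graph (e ∷ es)) w ≡ Descent.runs (just (lab graph e) , w) es
  descent-after e [] w = refl
  descent-after e (e' ∷ es) [] = refl
  descent-after e (e' ∷ es) (x ∷ w) = cong ((letter (lab graph e) (lab graph e') ==ab x) ∧_) (descent-after e' es w)

  wordPaths : ℕ → ℤ → List AB → ℕ
  wordPaths z ℓ [] = if ⌊ z ℕ.≟ T ⌋ then 1 else 0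
  wordPaths z ℓ (x ∷ w) =
    sumL (λ p → if letter ℓ (proj₂ p) ==ab x then wordPaths (proj₁ p) (proj₂ p) w else 0) (A z)

  wordPaths-correct : ∀ z ℓ w → Descent.paths z T (length w) (just ℓ , w) ≡ wordPaths z ℓ w
  wordPaths-correct z ℓ [] = cong (λ b → if b then 1 else 0) (∧-identityʳ ⌊ z ℕ.≟ T ⌋)
  wordPaths-correct z ℓ (x ∷ w) = sumL-cong (A z) (λ p _ →
    cong (λ n → if letter ℓ (proj₂ p) ==ab x then n else 0) (wordPaths-correct (proj₁ p) (proj₂ p) w))

  Ψ-from-source : ∀ w → ΨCoeff ℤ-order graph (vertex T 0) (vertex T T) w ≡
                        sumL (λ p → wordPaths (proj₁ p) (proj₂ p) w) (A 0)
  Ψ-from-source w = begin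
      ΨCoeff ℤ-order graph (vertex T 0) (vertex T T) w
    ≡⟨ countB-cong graph (seqs graph (suc (length w)))
         (λ es → cong (isPath graph (vertex T 0) es (vertex T T) ∧_) (word es)) ⟩
      countB graph (Descent.accepted (vertex T 0) (vertex T T) (nothing , w)) (seqs graph (suc (length w)))
    ≡⟨ Descent.paths-correct (suc (length w)) (vertex T 0) (vertex T T) (nothing , w) ⟩
      Descent.paths (toℕ (vertex T 0)) (toℕ (vertex T T)) (suc (length w)) (nothing , w)
    ≡⟨ cong₂ (λ s t → Descent.paths s t (suc (length w)) (nothing , w)) (toℕ-vertex {T} z≤n) (toℕ-vertex ≤-refl) ⟩
      sumL (λ p → Descent.paths (proj₁ p) T (length w) (just (proj₂ p) , w)) (A 0)
    ≡⟨ sumL-cong (A 0) (λ p _ → wordPaths-correct (proj₁ p) (proj₂ p) w) ⟩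
      sumL (λ p → wordPaths (proj₁ p) (proj₂ p) w) (A 0) ∎
    where
    open ≡-Reasoning
    word : ∀ es → listEq _==ab_ (descent ℤ-order graph es) w ≡ Descent.runs (nothing , w) es
    word [] = refl
    word (e ∷ es) = descent-after e es w

-- Lists whose entries sit at consecutive positions g, g+1, …: AllFrom P g xs says that
-- P (g + i) holds of the i-th entry; specAt xs i is the i-th entry, or [] beyond the end.

AllFrom : {X : Set} → (ℕ → X → Set) → ℕ → List X → Set
AllFrom P g [] = ⊤
AllFrom P g (x ∷ xs) = P g x × AllFrom P (suc g) xs

AllFrom-++⁺ : {X : Set} → ∀ (P : ℕ → X → Set) g xs ys →
              AllFrom P g xs → AllFrom P (g + length xs) ys → AllFrom P g (xs ++ ys)
AllFrom-++⁺ P g [] ys _ pys = subst (λ n → AllFrom P n ys) (+-identityʳ g) pys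
AllFrom-++⁺ P g (x ∷ xs) ys (px , pxs) pys =
  px , AllFrom-++⁺ P (suc g) xs ys pxs (subst (λ n → AllFrom P n ys) (ℕ.+-suc g (length xs)) pys)

AllFrom-++⁻ : {X : Set} → ∀ (P : ℕ → X → Set) g xs ys → AllFrom P g (xs ++ ys) →
               AllFrom P g xs × AllFrom P (g + length xs) ys
AllFrom-++⁻ P g [] ys pys = tt , subst (λ n → AllFrom P n ys) (sym (+-identityʳ g)) pys
AllFrom-++⁻ P g (x ∷ xs) ys (px , pxys) with AllFrom-++⁻ P (suc g) xs ys pxys
... | pxs , pys = (px , pxs) , subst (λ n → AllFrom P n ys) (sym (ℕ.+-suc g (length xs))) pys

AllFrom-map : {X : Set} {P Q : ℕ → X → Set} → (∀ {v x} → P v x → Q v x) →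
              ∀ g xs → AllFrom P g xs → AllFrom Q g xs
AllFrom-map P⇒Q g [] _ = tt
AllFrom-map P⇒Q g (x ∷ xs) (px , pxs) = P⇒Q px , AllFrom-map P⇒Q (suc g) xs pxs

AllFrom-suc⁺ : {X : Set} → ∀ (P : ℕ → X → Set) g xs → AllFrom (λ v → P (suc v)) g xs → AllFrom P (suc g) xs
AllFrom-suc⁺ P g [] _ = tt
AllFrom-suc⁺ P g (x ∷ xs) (px , pxs) = px , AllFrom-suc⁺ P (suc g) xs pxs

AllFrom-suc⁻ : {X : Set} → ∀ (P : ℕ → X → Set) g xs → AllFrom P (suc g) xs → AllFrom (λ v → P (suc v)) g xs
AllFrom-suc⁻ P g [] _ = tt
AllFrom-suc⁻ P g (x ∷ xs) (px , pxs) = px , AllFrom-suc⁻ P (suc g) xs pxs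

specAt : {X : Set} → List (List X) → ℕ → List X
specAt [] _ = []
specAt (L ∷ _) zero = L
specAt (_ ∷ Ls) (suc i) = specAt Ls i

AllFrom-specAt : {X : Set} (P : ℕ → List X → Set) (Ls : List (List X)) (i : ℕ) →
                 AllFrom P 0 Ls → i < length Ls → P i (specAt Ls i)
AllFrom-specAt P (L ∷ Ls) zero (pL , _) _ = pL
AllFrom-specAt P (L ∷ Ls) (suc i) (_ , pLs) (s≤s i<n) =
  AllFrom-specAt (λ v → P (suc v)) Ls i (AllFrom-suc⁻ P 0 Ls pLs) i<n

specAt-beyond : {X : Set} (Ls : List (List X)) (i : ℕ) → length Ls ≤ i → specAt Ls i ≡ []
specAt-beyond [] i _ = refl
specAt-beyond (L ∷ Ls) (suc i) (s≤s n≤i) = specAt-beyond Ls i n≤i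

specAt-self : {X : Set} (Ls : List (List X)) → AllFrom (λ v L → specAt Ls v ≡ L) 0 Ls
specAt-self [] = tt
specAt-self (L ∷ Ls) = refl , AllFrom-suc⁺ (λ v L' → specAt (L ∷ Ls) v ≡ L') 0 Ls (specAt-self Ls)

-- A step is the list of labels of a bundle of parallel edges; a chain is a non-empty
-- sequence of steps, i.e. a path of bundles.

Step : Set
Step = List ℤ

Chain : Set
Chain = List⁺ Step

chainWords : List Step → ℤ → List AB → ℕ
chainWords [] ℓ [] = 1
chainWords [] ℓ (_ ∷ _) = 0
chainWords (s ∷ r) ℓ [] = 0
chainWords (s ∷ r) ℓ (x ∷ w) = sumL (λ ℓ' → if letter ℓ ℓ' ==ab x then chainWords r ℓ' w else 0) s

chainΨ : Chain → List AB → ℕ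
chainΨ c w = sumL (λ ℓ → chainWords (tail c) ℓ w) (head c)

SymmetricStep : Step → Set
SymmetricStep s = ∀ (g : ℤ → ℕ) → sumL g s ≡ sumL (λ ℓ → g (- ℓ)) s

Inhabited : Step → Set
Inhabited s = ∃ (_∈ s)

-- the conditions on a chain under which bouquets of such chains are balanced and bounded:
-- every step has an edge, is invariant under negation, and shares no label with the next
record WellFormed (c : Chain) : Set where
  field
    inhabited : All Inhabited (toList c)
    symmetric : All SymmetricStep (toList c)
    separated : Linked Disjoint (toList c)

-- The bouquet of a non-empty list of chains: every chain runs from the source 0 to the
-- sink T through inner vertices of its own, numbered consecutively chain after chain.

module Bouquet (chains : List⁺ Chain) (wf : All WellFormed (toList chains)) where

  size : List Chain → ℕ
  size [] = 0
  size (c ∷ cs) = length (tail c) + size cs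

  T : ℕ
  T = suc (size (toList chains))

  Spec : Set
  Spec = List (ℕ × ℤ)

  edgesTo : ℕ → Step → Spec
  edgesTo z s = map (z ,_) s

  exit : ℕ → List Step → ℕ
  exit g [] = T
  exit g (_ ∷ _) = g

  innerSpecs : ℕ → List Step → List Spec
  innerSpecs g [] = []
  innerSpecs g (s ∷ r) = edgesTo (exit (suc g) r) s ∷ innerSpecs (suc g) r

  sourceSpec : ℕ → List Chain → Spec
  sourceSpec b [] = []
  sourceSpec b (c ∷ cs) = edgesTo (exit b (tail c)) (head c) ++ sourceSpec (b + length (tail c)) cs

  allInner : ℕ → List Chain → List Spec
  allInner b [] = []
  allInner b (c ∷ cs) = innerSpecs b (tail c) ++ allInner (b + length (tail c)) cs

  specs : List Spec
  specs = sourceSpec 1 (toList chains) ∷ allInner 1 (toList chains)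

  A : ℕ → Spec
  A = specAt specs

  length-innerSpecs : ∀ g r → length (innerSpecs g r) ≡ length r
  length-innerSpecs g [] = refl
  length-innerSpecs g (s ∷ r) = cong suc (length-innerSpecs (suc g) r)

  length-specs : length specs ≡ T
  length-specs = cong suc (length-allInner 1 (toList chains))
    where
    length-allInner : ∀ b cs → length (allInner b cs) ≡ size cs
    length-allInner b [] = refl
    length-allInner b (c ∷ cs) = trans (length-++ (innerSpecs b (tail c)))
      (cong₂ _+_ (length-innerSpecs b (tail c)) (length-allInner (b + length (tail c)) cs))

  T-final : ∀ {p} → ¬ (p ∈ A T)
  T-final p∈ = ¬Any[] (subst (_ ∈_) (specAt-beyond specs T (ℕ.≤-reflexive length-specs)) p∈)

  A-below : (P : ℕ → Spec → Set) → P 0 (A 0) → AllFrom P 1 (allInner 1 (toList chains)) →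
            ∀ v → v < T → P v (A v)
  A-below P p0 p-inner v v<T = AllFrom-specAt P specs v (p0 , p-inner) (subst (v <_) (sym length-specs) v<T)

  A-all : (P : ℕ → Spec → Set) → (∀ v → P v []) → P 0 (A 0) → AllFrom P 1 (allInner 1 (toList chains)) →
          ∀ v → P v (A v)
  A-all P p-nil p0 p-inner v with v ℕ.<? T
  ... | yes v<T = A-below P p0 p-inner v v<T
  ... | no v≮T = subst (P v) (sym (specAt-beyond specs v (subst (_≤ v) (sym length-specs) (ℕ.≮⇒≥ v≮T)))) (p-nil v)

  Laid : ℕ → Spec → Set
  Laid v L = A v ≡ L

  record Placed (b : ℕ) (c : Chain) : Set where
    field
      wellFormed : WellFormed c
      positive : 1 ≤ b
      fits : b + length (tail c) ≤ T
      laidOut : AllFrom Laid b (innerSpecs b (tail c))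
      fromSource : edgesTo (exit b (tail c)) (head c) ⊆ A 0

  AllPlaced : ℕ → List Chain → Set
  AllPlaced b [] = ⊤
  AllPlaced b (c ∷ cs) = Placed b c × AllPlaced (b + length (tail c)) cs

  placed : AllPlaced 1 (toList chains)
  placed = place 1 (toList chains) wf refl ≤-refl (proj₂ (specAt-self specs)) (λ p∈ → p∈)
    where
    place : ∀ b cs → All WellFormed cs → b + size cs ≡ T → 1 ≤ b →
            AllFrom Laid b (allInner b cs) → sourceSpec b cs ⊆ A 0 → AllPlaced b cs
    place b [] _ _ _ _ _ = tt
    place b (c ∷ cs) (wf-c ∷ wf-cs) total positive laid source = first , rest
      where
      split = AllFrom-++⁻ Laid b (innerSpecs b (tail c)) (allInner (b + length (tail c)) cs) laid
      total′ : b + length (tail c) + size cs ≡ T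
      total′ = trans (+-assoc b _ _) total
      first : Placed b c
      first = record
        { wellFormed = wf-c ; positive = positive
        ; fits = ℕ.≤-trans (ℕ.m≤m+n (b + length (tail c)) (size cs)) (ℕ.≤-reflexive total′)
        ; laidOut = proj₁ split
        ; fromSource = λ p∈ → source (∈-++⁺ˡ p∈) }
      rest : AllPlaced (b + length (tail c)) cs
      rest = place (b + length (tail c)) cs wf-cs total′ (ℕ.≤-trans positive (ℕ.m≤m+n b _))
        (subst (λ n → AllFrom Laid n (allInner (b + length (tail c)) cs))
               (cong (b +_) (length-innerSpecs b (tail c))) (proj₂ split))
        (λ p∈ → source (∈-++⁺ʳ (edgesTo (exit b (tail c)) (head c)) p∈))

  inner-all : (P : ℕ → Spec → Set) → (∀ {b c} → Placed b c → AllFrom P b (innerSpecs b (tail c))) →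
              ∀ b cs → AllPlaced b cs → AllFrom P b (allInner b cs)
  inner-all P each b [] _ = tt
  inner-all P each b (c ∷ cs) (pc , pcs) = AllFrom-++⁺ P b (innerSpecs b (tail c)) _ (each pc)
    (subst (λ n → AllFrom P n (allInner (b + length (tail c)) cs)) (sym (cong (b +_) (length-innerSpecs b (tail c))))
           (inner-all P each (b + length (tail c)) cs pcs))

  source-all : (Q : ℕ × ℤ → Set) →
               (∀ {b c} → Placed b c → ∀ {p} → p ∈ edgesTo (exit b (tail c)) (head c) → Q p) →
               ∀ b cs → AllPlaced b cs → ∀ {p} → p ∈ sourceSpec b cs → Q p
  source-all Q each b (c ∷ cs) (pc , pcs) p∈ with ∈-++⁻ (edgesTo (exit b (tail c)) (head c)) p∈
  ... | inj₁ p∈c = each pc p∈c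
  ... | inj₂ p∈cs = source-all Q each (b + length (tail c)) cs pcs p∈cs

  source-sum : (f : ℕ × ℤ → ℕ) (g : Chain → ℕ) →
               (∀ {b c} → Placed b c → sumL f (edgesTo (exit b (tail c)) (head c)) ≡ g c) →
               ∀ b cs → AllPlaced b cs → sumL f (sourceSpec b cs) ≡ sumL g cs
  source-sum f g each b [] _ = refl
  source-sum f g each b (c ∷ cs) (pc , pcs) = trans (sumL-++ f (edgesTo (exit b (tail c)) (head c)) _)
    (cong₂ _+_ (each pc) (source-sum f g each (b + length (tail c)) cs pcs))

  ∈-edgesTo : ∀ {z s z' ℓ} → (z' , ℓ) ∈ edgesTo z s → z' ≡ z × ℓ ∈ s
  ∈-edgesTo {z} p∈ with ∈-map⁻ (z ,_) p∈
  ... | _ , ℓ∈ , refl = refl , ℓ∈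

  ∈-edgesTo⁺ : ∀ {z s ℓ} → ℓ ∈ s → (z , ℓ) ∈ edgesTo z s
  ∈-edgesTo⁺ {z} = ∈-map⁺ (z ,_)

  exit-bounds : ∀ g r → g + length r ≤ T → g ≤ exit g r × exit g r ≤ T
  exit-bounds g [] fits = subst (_≤ T) (+-identityʳ g) fits , ≤-refl
  exit-bounds g (_ ∷ r) fits = ≤-refl , ℕ.≤-trans (ℕ.m≤m+n g _) fits

  Forward : ℕ → Spec → Set
  Forward v L = ∀ {z ℓ} → (z , ℓ) ∈ L → v < z × z ≤ T

  inner-forward : ∀ g r → g + length r ≤ T → AllFrom Forward g (innerSpecs g r)
  inner-forward g [] _ = tt
  inner-forward g (s ∷ r) fits = step-forward , inner-forward (suc g) r fits′
    where
    fits′ : suc g + length r ≤ T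
    fits′ = subst (_≤ T) (ℕ.+-suc g (length r)) fits
    step-forward : Forward g (edgesTo (exit (suc g) r) s)
    step-forward p∈ with ∈-edgesTo p∈
    ... | refl , _ = ℕ.<-≤-trans (ℕ.n<1+n g) (proj₁ bounds) , proj₂ bounds
      where bounds = exit-bounds (suc g) r fits′

  source-forward : ∀ {b c} → Placed b c → ∀ {p} → p ∈ edgesTo (exit b (tail c)) (head c) →
                   0 < proj₁ p × proj₁ p ≤ T
  source-forward {b} {c} pc p∈ with ∈-edgesTo p∈
  ... | refl , _ = ℕ.<-≤-trans (Placed.positive pc) (proj₁ bounds) , proj₂ bounds
    where bounds = exit-bounds b (tail c) (Placed.fits pc)

  forward : ∀ {a z ℓ} → (z , ℓ) ∈ A a → a < z × z ≤ T
  forward {a} = A-all Forward (λ _ ()) (source-all _ source-forward 1 (toList chains) placed)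
                      (inner-all Forward (λ pc → inner-forward _ _ (Placed.fits pc)) 1 (toList chains) placed) a

  open ForwardGraph T A forward public

  edgesTo-symmetric : ∀ z s → SymmetricStep s → Symmetric (edgesTo z s)
  edgesTo-symmetric z s s-sym g = begin
    sumL g (edgesTo z s)                            ≡⟨ sumL-map g (z ,_) s ⟩
    sumL (λ ℓ → g (z , ℓ)) s                        ≡⟨ s-sym (λ ℓ → g (z , ℓ)) ⟩
    sumL (λ ℓ → g (z , - ℓ)) s                      ≡⟨ sumL-map (λ p → g (proj₁ p , - proj₂ p)) (z ,_) s ⟨
    sumL (λ p → g (proj₁ p , - proj₂ p)) (edgesTo z s) ∎
    where open ≡-Reasoning

  source-symmetric : ∀ b cs → AllPlaced b cs → Symmetric (sourceSpec b cs)
  source-symmetric b [] _ g = refl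
  source-symmetric b (c ∷ cs) (pc , pcs) g = begin
      sumL g (first ++ sourceSpec b′ cs)
    ≡⟨ sumL-++ g first _ ⟩
      sumL g first + sumL g (sourceSpec b′ cs)
    ≡⟨ cong₂ _+_ (edgesTo-symmetric _ (head c) (All.head (WellFormed.symmetric (Placed.wellFormed pc))) g)
                 (source-symmetric b′ cs pcs g) ⟩
      sumL g′ first + sumL g′ (sourceSpec b′ cs)
    ≡⟨ sumL-++ g′ first _ ⟨
      sumL g′ (first ++ sourceSpec b′ cs) ∎
    where
    open ≡-Reasoning
    first = edgesTo (exit b (tail c)) (head c)
    b′ = b + length (tail c)
    g′ : ℕ × ℤ → ℕ
    g′ p = g (proj₁ p , - proj₂ p)

  inner-symmetric : ∀ g r → All SymmetricStep r → AllFrom (λ _ → Symmetric) g (innerSpecs g r)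
  inner-symmetric g [] _ = tt
  inner-symmetric g (s ∷ r) (s-sym ∷ r-sym) = edgesTo-symmetric _ s s-sym , inner-symmetric (suc g) r r-sym

  A-symmetric : ∀ a → Symmetric (A a)
  A-symmetric = A-all (λ _ → Symmetric) (λ _ _ → refl) (source-symmetric 1 (toList chains) placed)
    (inner-all _ (λ {b} {c} pc → inner-symmetric b (tail c) (All.tail (WellFormed.symmetric (Placed.wellFormed pc))))
               1 (toList chains) placed)

  Fresh : Spec → Set
  Fresh L = ∀ {z ℓ z' ℓ'} → (z , ℓ) ∈ L → (z' , ℓ') ∈ A z → ℓ' ≢ ℓ

  step-fresh : ∀ g s r → Linked Disjoint (s ∷ r) → AllFrom Laid g (innerSpecs g r) → Fresh (edgesTo (exit g r) s)
  step-fresh g s [] _ _ p∈ p'∈ with ∈-edgesTo p∈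
  ... | refl , _ = ⊥-elim (T-final p'∈)
  step-fresh g s (s' ∷ r) (s∩s'=∅ ∷ _) (laid , _) p∈ p'∈ with ∈-edgesTo p∈
  ... | refl , ℓ∈s with ∈-edgesTo (subst (_ ∈_) laid p'∈)
  ...   | _ , ℓ'∈s' = λ ℓ'≡ℓ → s∩s'=∅ (ℓ∈s , subst (_∈ s') ℓ'≡ℓ ℓ'∈s')

  inner-fresh : ∀ g r → Linked Disjoint r → AllFrom Laid g (innerSpecs g r) →
                AllFrom (λ _ → Fresh) g (innerSpecs g r)
  inner-fresh g [] _ _ = tt
  inner-fresh g (s ∷ r) linked (_ , laid) =
    step-fresh (suc g) s r linked laid , inner-fresh (suc g) r (Linked.tail linked) laid

  A-fresh : ∀ {a z ℓ z' ℓ'} → (z , ℓ) ∈ A a → (z' , ℓ') ∈ A z → ℓ' ≢ ℓ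
  A-fresh {a} = A-all (λ _ → Fresh) (λ _ ()) (λ p∈ p'∈ → source-all Next source-fresh 1 (toList chains) placed p∈ p'∈)
    (inner-all _ (λ {b} {c} pc → inner-fresh b (tail c) (Linked.tail (separated pc)) (Placed.laidOut pc))
                 1 (toList chains) placed) a
    where
    separated : ∀ {b c} → Placed b c → Linked Disjoint (toList c)
    separated pc = WellFormed.separated (Placed.wellFormed pc)
    Next : ℕ × ℤ → Set
    Next p = ∀ {z' ℓ'} → (z' , ℓ') ∈ A (proj₁ p) → ℓ' ≢ proj₂ p
    source-fresh : ∀ {b c} → Placed b c → ∀ {p} → p ∈ edgesTo (exit b (tail c)) (head c) → Next p
    source-fresh {b} {c} pc p∈ = step-fresh b (head c) (tail c) (separated pc) (Placed.laidOut pc) p∈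

  Entered : ℕ → Set
  Entered v = ∃₂ λ a ℓ → (v , ℓ) ∈ A a

  entered-along : ∀ a g s r → Inhabited s → All Inhabited r → edgesTo (exit g r) s ⊆ A a →
                  AllFrom Laid g (innerSpecs g r) → AllFrom (λ v _ → Entered v) g (innerSpecs g r) × Entered T
  entered-along a g s [] (ℓ , ℓ∈) _ s⊆ _ = tt , a , ℓ , s⊆ (∈-edgesTo⁺ ℓ∈)
  entered-along a g s (s' ∷ r) (ℓ , ℓ∈) (s'-inh ∷ r-inh) s⊆ (laid , laids)
    with entered-along g (suc g) s' r s'-inh r-inh (λ p∈ → subst (_ ∈_) (sym laid) p∈) laids
  ... | later , T-entered = ((a , ℓ , s⊆ (∈-edgesTo⁺ ℓ∈)) , later) , T-entered

  chain-entered : ∀ {b c} → Placed b c → AllFrom (λ v _ → Entered v) b (innerSpecs b (tail c)) × Entered T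
  chain-entered {b} {c} pc with WellFormed.inhabited (Placed.wellFormed pc)
  ... | inh ∷ inhs = entered-along 0 b (head c) (tail c) inh inhs (Placed.fromSource pc) (Placed.laidOut pc)

  has-in : ∀ v → 0 < v → v ≤ T → Entered v
  has-in v 0<v v≤T with ℕ.m≤n⇒m<n∨m≡n v≤T
  ... | inj₁ v<T = A-below (λ v _ → 0 < v → Entered v) (λ ())
                     (AllFrom-map (λ e _ → e) 1 _ (inner-all _ (λ pc → proj₁ (chain-entered pc)) 1 (toList chains) placed))
                     v v<T 0<v
  ... | inj₂ refl = proj₂ (chain-entered (proj₁ placed))

  inner-out : ∀ g r → All Inhabited r → AllFrom (λ _ L → ∃ (_∈ L)) g (innerSpecs g r)
  inner-out g [] _ = tt
  inner-out g (s ∷ r) ((ℓ , ℓ∈) ∷ inhs) = (_ , ∈-edgesTo⁺ ℓ∈) , inner-out (suc g) r inhs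

  has-out : ∀ v → v < T → ∃ (_∈ A v)
  has-out = A-below (λ _ L → ∃ (_∈ L)) source-out
    (inner-all _ (λ {b} {c} pc → inner-out b (tail c) (All.tail (inhabited pc))) 1 (toList chains) placed)
    where
    inhabited : ∀ {b c} → Placed b c → All Inhabited (toList c)
    inhabited pc = WellFormed.inhabited (Placed.wellFormed pc)
    source-out : ∃ (_∈ A 0)
    source-out with All.head (inhabited (proj₁ placed))
    ... | ℓ , ℓ∈ = _ , Placed.fromSource (proj₁ placed) (∈-edgesTo⁺ ℓ∈)

  exit-words : ∀ g r → AllFrom Laid g (innerSpecs g r) → g + length r ≤ T →
               ∀ ℓ w → wordPaths (exit g r) ℓ w ≡ chainWords r ℓ w
  exit-words g [] _ _ ℓ [] with T ℕ.≟ T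
  ... | yes _ = refl
  ... | no T≢T = ⊥-elim (T≢T refl)
  exit-words g [] _ _ ℓ (x ∷ w) = cong (sumL _) (specAt-beyond specs T (ℕ.≤-reflexive length-specs))
  exit-words g (s ∷ r) _ fits ℓ [] with g ℕ.≟ T
  ... | yes refl = ⊥-elim (<-irrefl refl (ℕ.<-≤-trans (ℕ.m<m+n g (s≤s z≤n)) fits))
  ... | no _ = refl
  exit-words g (s ∷ r) (laid , laids) fits ℓ (x ∷ w) = begin
      wordPaths g ℓ (x ∷ w)
    ≡⟨ cong (sumL step) laid ⟩
      sumL step (edgesTo (exit (suc g) r) s)
    ≡⟨ sumL-map step (exit (suc g) r ,_) s ⟩
      sumL (λ ℓ' → step (exit (suc g) r , ℓ')) s
    ≡⟨ sumL-cong s (λ ℓ' _ → cong (λ n → if letter ℓ ℓ' ==ab x then n else 0)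
                                  (exit-words (suc g) r laids (subst (_≤ T) (ℕ.+-suc g (length r)) fits) ℓ' w)) ⟩
      chainWords (s ∷ r) ℓ (x ∷ w) ∎
    where
    open ≡-Reasoning
    step : ℕ × ℤ → ℕ
    step p = if letter ℓ (proj₂ p) ==ab x then wordPaths (proj₁ p) (proj₂ p) w else 0

  bouquet-unique-source : IsUniqueSource graph (vertex T 0)
  bouquet-unique-source = unique-source has-in

  bouquet-unique-sink : IsUniqueSink graph (vertex T T)
  bouquet-unique-sink = unique-sink has-out

  bouquet-balanced : Balanced ℤ-order graph
  bouquet-balanced = balanced A-symmetric (λ {a} → A-fresh {a})

  bouquet-Ψ : ∀ w → ΨCoeff ℤ-order graph (vertex T 0) (vertex T T) w ≡ sumL (λ c → chainΨ c w) (toList chains)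
  bouquet-Ψ w = trans (Ψ-from-source w) (source-sum _ (λ c → chainΨ c w) chain-Ψ 1 (toList chains) placed)
    where
    chain-Ψ : ∀ {b c} → Placed b c →
              sumL (λ p → wordPaths (proj₁ p) (proj₂ p) w) (edgesTo (exit b (tail c)) (head c)) ≡ chainΨ c w
    chain-Ψ {b} {c} pc = trans (sumL-map _ (exit b (tail c) ,_) (head c))
      (sumL-cong (head c) (λ ℓ _ → exit-words b (tail c) (Placed.laidOut pc) (Placed.fits pc) ℓ w))

-- With h the degree of the rest of the monomial, a letter
-- c becomes a pair of parallel edges labelled ±(h+1), a letter d an edge labelled 0
-- followed by such a pair, and the empty monomial an edge labelled 0.  All labels of the
-- rest lie strictly between -(h+1) and h+1, so leaving +(h+1) is a descent and leaving
-- -(h+1) an ascent: the pair produces c = a + b, and 0 followed by the pair produces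
-- d = ab + ba.

deg : List CD → ℕ
deg [] = 0
deg (𝐜 ∷ m) = suc (deg m)
deg (𝐝 ∷ m) = suc (suc (deg m))

zeroStep : Step
zeroStep = ℤ.+ 0 ∷ []

pairStep : ℕ → Step
pairStep h = ℤ.+[1+ h ] ∷ ℤ.-[1+ h ] ∷ []

monoChain : List CD → Chain
monoChain [] = [ zeroStep ]
monoChain (𝐜 ∷ m) = pairStep (deg m) ∷⁺ monoChain m
monoChain (𝐝 ∷ m) = zeroStep ∷⁺ pairStep (deg m) ∷⁺ monoChain m

Inside : ℕ → Step → Set
Inside h s = All (λ ℓ → ℤ.-[1+ h ] ℤ.< ℓ × ℓ ℤ.< ℤ.+[1+ h ]) s

zero-inside : ∀ h → Inside h zeroStep
zero-inside h = (ℤ.-<+ , ℤ.+<+ (s≤s z≤n)) ∷ All.[]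

head-inside : ∀ m → Inside (deg m) (head (monoChain m))
head-inside [] = zero-inside 0
head-inside (𝐜 ∷ m) = (ℤ.-<+ , ℤ.+<+ (s≤s (ℕ.n<1+n (deg m))))
                    ∷ (ℤ.-<- (ℕ.n<1+n (deg m)) , ℤ.-<+) ∷ All.[]
head-inside (𝐝 ∷ m) = zero-inside _

letter-< : ∀ {ℓ ℓ'} → ℓ ℤ.< ℓ' → letter ℓ ℓ' ≡ 𝐚
letter-< {ℓ} {ℓ'} ℓ<ℓ' with ℓ <? ℓ'
... | yes _ = refl
... | no ℓ≮ℓ' = ⊥-elim (ℓ≮ℓ' ℓ<ℓ')

letter-> : ∀ {ℓ ℓ'} → ℓ' ℤ.< ℓ → letter ℓ ℓ' ≡ 𝐛
letter-> {ℓ} {ℓ'} ℓ'<ℓ with ℓ <? ℓ'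
... | yes ℓ<ℓ' = ⊥-elim (ℤ.<-asym ℓ<ℓ' ℓ'<ℓ)
... | no _ = refl

enter-chain : ∀ C ℓ y x w → All (λ ℓ' → letter ℓ ℓ' ≡ y) (head C) →
              chainWords (toList C) ℓ (x ∷ w) ≡ (if y ==ab x then chainΨ C w else 0)
enter-chain C ℓ y x w same = trans
  (sumL-cong (head C) (λ ℓ' ℓ'∈ →
     cong (λ z → if z ==ab x then chainWords (tail C) ℓ' w else 0) (All.lookup same ℓ'∈)))
  (sumL-guard (y ==ab x) (λ ℓ' → chainWords (tail C) ℓ' w) (head C))

from-top : ∀ m x w → chainWords (toList (monoChain m)) ℤ.+[1+ deg m ] (x ∷ w) ≡
                      (if 𝐛 ==ab x then chainΨ (monoChain m) w else 0)
from-top m x w = enter-chain (monoChain m) _ 𝐛 x w (All.map (λ bounds → letter-> (proj₂ bounds)) (head-inside m))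

from-bottom : ∀ m x w → chainWords (toList (monoChain m)) ℤ.-[1+ deg m ] (x ∷ w) ≡
                         (if 𝐚 ==ab x then chainΨ (monoChain m) w else 0)
from-bottom m x w = enter-chain (monoChain m) _ 𝐚 x w (All.map (λ bounds → letter-< (proj₁ bounds)) (head-inside m))

monoChain-Ψ : ∀ m w → chainΨ (monoChain m) w ≡ expCount m w
monoChain-Ψ [] [] = refl
monoChain-Ψ [] (_ ∷ _) = refl
monoChain-Ψ (𝐜 ∷ m) [] = refl
monoChain-Ψ (𝐜 ∷ m) (x ∷ w) rewrite from-top m x w | from-bottom m x w with x
... | 𝐚 = trans (+-identityʳ _) (monoChain-Ψ m w)
... | 𝐛 = trans (+-identityʳ _) (monoChain-Ψ m w)
monoChain-Ψ (𝐝 ∷ m) [] = refl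
monoChain-Ψ (𝐝 ∷ m) (x ∷ w)
  rewrite letter-< {ℤ.+ 0} {ℤ.+[1+ deg m ]} (ℤ.+<+ (s≤s z≤n))
        | letter-> {ℤ.+ 0} {ℤ.-[1+ deg m ]} ℤ.-<+ = after-d x w
  where
  after-d : ∀ x w → ((if 𝐚 ==ab x then chainWords (toList (monoChain m)) ℤ.+[1+ deg m ] w else 0)
                     + ((if 𝐛 ==ab x then chainWords (toList (monoChain m)) ℤ.-[1+ deg m ] w else 0) + 0)) + 0
                    ≡ expCount (𝐝 ∷ m) (x ∷ w)
  after-d 𝐚 [] = refl
  after-d 𝐛 [] = refl
  after-d x (y ∷ w) rewrite from-top m y w | from-bottom m y w with x | y
  ... | 𝐚 | 𝐚 = refl
  ... | 𝐚 | 𝐛 = trans (+-identityʳ _) (trans (+-identityʳ _) (monoChain-Ψ m w))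
  ... | 𝐛 | 𝐚 = trans (+-identityʳ _) (trans (+-identityʳ _) (monoChain-Ψ m w))
  ... | 𝐛 | 𝐛 = refl

pair-symmetric : ∀ h → SymmetricStep (pairStep h)
pair-symmetric h g = begin
  g ℤ.+[1+ h ] + (g ℤ.-[1+ h ] + 0)  ≡⟨ cong (g ℤ.+[1+ h ] +_) (+-identityʳ _) ⟩
  g ℤ.+[1+ h ] + g ℤ.-[1+ h ]        ≡⟨ ℕ.+-comm (g ℤ.+[1+ h ]) _ ⟩
  g ℤ.-[1+ h ] + g ℤ.+[1+ h ]        ≡⟨ cong (g ℤ.-[1+ h ] +_) (+-identityʳ _) ⟨
  g ℤ.-[1+ h ] + (g ℤ.+[1+ h ] + 0)  ∎
  where open ≡-Reasoning

pair-disjoint : ∀ {h s} → Inside h s → Disjoint (pairStep h) s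
pair-disjoint inside (here refl , ℓ∈s) = ℤ.<-irrefl refl (proj₂ (All.lookup inside ℓ∈s))
pair-disjoint inside (there (here refl) , ℓ∈s) = ℤ.<-irrefl refl (proj₁ (All.lookup inside ℓ∈s))

monoChain-inhabited : ∀ m → All Inhabited (toList (monoChain m))
monoChain-inhabited [] = (_ , here refl) ∷ All.[]
monoChain-inhabited (𝐜 ∷ m) = (_ , here refl) ∷ monoChain-inhabited m
monoChain-inhabited (𝐝 ∷ m) = (_ , here refl) ∷ (_ , here refl) ∷ monoChain-inhabited m

monoChain-symmetric : ∀ m → All SymmetricStep (toList (monoChain m))
monoChain-symmetric [] = (λ _ → refl) ∷ All.[]
monoChain-symmetric (𝐜 ∷ m) = pair-symmetric (deg m) ∷ monoChain-symmetric m
monoChain-symmetric (𝐝 ∷ m) = (λ _ → refl) ∷ pair-symmetric (deg m) ∷ monoChain-symmetric m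

monoChain-separated : ∀ m → Linked Disjoint (toList (monoChain m))
monoChain-separated [] = Linked.[-]
monoChain-separated (𝐜 ∷ m) = pair-disjoint (head-inside m) ∷ monoChain-separated m
monoChain-separated (𝐝 ∷ m) = zero-pair ∷ pair-disjoint (head-inside m) ∷ monoChain-separated m
  where
  zero-pair : Disjoint zeroStep (pairStep (deg m))
  zero-pair (0∈ , 0∈pair) = pair-disjoint (zero-inside (deg m)) (0∈pair , 0∈)

monoChain-wellFormed : ∀ m → WellFormed (monoChain m)
monoChain-wellFormed m = record
  { inhabited = monoChain-inhabited m
  ; symmetric = monoChain-symmetric m
  ; separated = monoChain-separated m }

monomials : CDPoly → List (List CD)
monomials [] = []
monomials ((m , k) ∷ u) = replicate k m ++ monomials u

sumL-replicate : {X : Set} (f : X → ℕ) (k : ℕ) (x : X) → sumL f (replicate k x) ≡ k * f x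
sumL-replicate f zero x = refl
sumL-replicate f (suc k) x = cong (f x +_) (sumL-replicate f k x)

monomials-expansion : ∀ u w → sumL (λ m → expCount m w) (monomials u) ≡ abCoeff u w
monomials-expansion [] w = refl
monomials-expansion ((m , k) ∷ u) w = trans (sumL-++ _ (replicate k m) (monomials u))
  (cong₂ _+_ (sumL-replicate (λ m → expCount m w) k m) (monomials-expansion u w))

monomials-nonempty : ∀ u m → cdCoeff u m ≢ 0 → Σ (List⁺ (List CD)) λ ms → monomials u ≡ toList ms
monomials-nonempty [] m c≢0 = ⊥-elim (c≢0 refl)
monomials-nonempty ((m' , zero) ∷ u) m c≢0 with listEq _==cd_ m' m
... | true = monomials-nonempty u m c≢0
... | false = monomials-nonempty u m c≢0
monomials-nonempty ((m' , suc k) ∷ u) m _ = (m' ∷ (replicate k m' ++ monomials u)) , refl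

theorem8p1 : (u : CDPoly) → (∃ λ (m : List CD) → ¬ (cdCoeff u m ≡ 0)) →
    Σ (StrictTotalOrder 0ℓ 0ℓ 0ℓ) λ O →
    Σ (LDigraph (StrictTotalOrder.Carrier O)) λ G →
    Σ (Vert G) λ s → Σ (Vert G) λ t →
      Acyclic G × IsUniqueSource G s × IsUniqueSink G t × Balanced O G
      × ((w : List AB) → ΨCoeff O G s t w ≡ abCoeff u w)
theorem8p1 u (m , coeff≢0) with monomials-nonempty u m coeff≢0
... | ms , monomials≡ =
  ℤ-order , graph , vertex T 0 , vertex T T ,
  acyclic , bouquet-unique-source , bouquet-unique-sink , bouquet-balanced , Ψ≡u
  where
  open Bouquet (List⁺.map monoChain ms) (All.map⁺ (All.universal monoChain-wellFormed (toList ms)))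
  Ψ≡u : ∀ w → ΨCoeff ℤ-order graph (vertex T 0) (vertex T T) w ≡ abCoeff u w
  Ψ≡u w = begin
    ΨCoeff ℤ-order graph (vertex T 0) (vertex T T) w        ≡⟨ bouquet-Ψ w ⟩
    sumL (λ c → chainΨ c w) (map monoChain (toList ms))     ≡⟨ sumL-map _ monoChain (toList ms) ⟩
    sumL (λ m → chainΨ (monoChain m) w) (toList ms)          ≡⟨ sumL-cong (toList ms) (λ m _ → monoChain-Ψ m w) ⟩
    sumL (λ m → expCount m w) (toList ms)                    ≡⟨ cong (sumL (λ m → expCount m w)) monomials≡ ⟨
    sumL (λ m → expCount m w) (monomials u)                  ≡⟨ monomials-expansion u w ⟩
    abCoeff u w                                              ∎
    where open ≡-Reasoning
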